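{- Let $x,e,p$ be nonnegative integers with $p\le x$ and $x\ge\frac53 e$. Then $$0\le\sum_{t=0}^e(-1)^t\binom{e}{t}\frac{1}{(x+t)!}\le\frac{1}{(x-p)!}.$$ -}

module Defs where

open import Data.Nat using (ℕ; suc; _+_; _!)
open import Data.Nat.Properties using (_!≢0)
open import Data.Nat.Combinatorics using (_C_)
open import Data.Integer as ℤ using (ℤ; +_; -1ℤ)
open import Data.Rational using (ℚ; 0ℚ; _/_) renaming (_+_ to _+ℚ_)
open import Data.List using (List; map; foldr; upTo)

invFact : ℕ → ℚ
invFact n = _/_ (+ 1) (n !) {{n !≢0}}

term : ℕ → ℕ → ℕ → ℚ
term x e t = _/_ ((-1ℤ ℤ.^ t) ℤ.* (+ (e C t))) ((x + t) !) {{(x + t) !≢0}}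

S : ℕ → ℕ → ℚ
S x e = foldr _+ℚ_ 0ℚ (map (term x e) (upTo (suc e)))

-- Write a_t = C(e,t)/(x+t)!, so that S x e = a_0 - a_1 + a_2 - ... ± a_e. Since
-- C(e,t+1) ≤ e C(e,t) ≤ (x+t+1) C(e,t) as soon as e ≤ x + 1 (implied by 5e ≤ 3x),
-- the a_t are nonincreasing, and the alternating-series bound gives
-- 0 ≤ S x e ≤ a_0 = 1/x! ≤ 1/(x-p)!.
module Submission where

open import Defs
open import Data.Nat using (ℕ; _∸_; _*_) renaming (_≤_ to _≤ℕ_)
open import Data.Rational using (0ℚ; _≤_)
open import Data.Product using (_×_; _,_)

open import Function using (_∘_)
open import Data.Nat as ℕ using (zero; suc; _+_; _!; z≤n; s≤s; _≤′_; ≤′-refl; ≤′-step)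
open import Data.Nat.Properties as ℕ using (_!≢0)
open import Data.Nat.Combinatorics using (_C_; nC1≡n; nCk+nC[k+1]≡[n+1]C[k+1])
open import Data.Integer as ℤ using (+_; -1ℤ)
import Data.Integer.Properties as ℤ
open import Data.Rational as ℚ using (ℚ; 1ℚ; _/_; _-_; toℚᵘ)
import Data.Rational.Properties as ℚ
import Data.Rational.Unnormalised as ℚᵘ
import Data.Rational.Unnormalised.Properties as ℚᵘ
open import Data.List using (foldr; map; upTo; applyUpTo)
open import Data.List.Properties using (map-upTo)
open import Relation.Binary.PropositionalEquality

nC[k+1]≤n*nCk : ∀ n k → n C suc k ≤ℕ n * (n C k)
nC[k+1]≤n*nCk zero    k       = z≤n
nC[k+1]≤n*nCk (suc n) zero    = ℕ.≤-reflexive (trans (nC1≡n (suc n)) (sym (ℕ.*-identityʳ (suc n))))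
nC[k+1]≤n*nCk (suc n) (suc k) = begin
  suc n C suc (suc k)               ≡⟨ nCk+nC[k+1]≡[n+1]C[k+1] n (suc k) ⟨
  n C suc k + n C suc (suc k)       ≤⟨ ℕ.+-mono-≤ (nC[k+1]≤n*nCk n k) (nC[k+1]≤n*nCk n (suc k)) ⟩
  n * (n C k) + n * (n C suc k)     ≡⟨ ℕ.*-distribˡ-+ n (n C k) (n C suc k) ⟨
  n * (n C k + n C suc k)           ≤⟨ ℕ.*-monoˡ-≤ (n C k + n C suc k) (ℕ.n≤1+n n) ⟩
  suc n * (n C k + n C suc k)       ≡⟨ cong (suc n *_) (nCk+nC[k+1]≡[n+1]C[k+1] n k) ⟩
  suc n * (suc n C suc k)           ∎
  where open ℕ.≤-Reasoning

!-mono-≤ : ∀ {m n} → m ≤ℕ n → m ! ≤ℕ n !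
!-mono-≤ m≤n = go (ℕ.≤⇒≤′ m≤n)
  where
  go : ∀ {m n} → m ≤′ n → m ! ≤ℕ n !
  go ≤′-refl              = ℕ.≤-refl
  go (≤′-step {n} m≤′n) = ℕ.≤-trans (go m≤′n) (ℕ.m≤n*m (n !) (suc n))

eC[t+1]*n!≤eCt*[n+1]! : ∀ {e n} t → e ≤ℕ suc n → (e C suc t) * n ! ≤ℕ (e C t) * suc n !
eC[t+1]*n!≤eCt*[n+1]! {e} {n} t e≤1+n = begin
  (e C suc t) * n !              ≤⟨ ℕ.*-monoˡ-≤ (n !) (nC[k+1]≤n*nCk e t) ⟩
  e * (e C t) * n !              ≤⟨ ℕ.*-monoˡ-≤ (n !) (ℕ.*-monoˡ-≤ (e C t) e≤1+n) ⟩
  suc n * (e C t) * n !          ≡⟨ cong (_* n !) (ℕ.*-comm (suc n) (e C t)) ⟩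
  (e C t) * suc n * n !          ≡⟨ ℕ.*-assoc (e C t) (suc n) (n !) ⟩
  (e C t) * suc n !              ∎
  where open ℕ.≤-Reasoning

toℚᵘ-/ : ∀ i k → toℚᵘ (i / suc k) ℚᵘ.≃ ℚᵘ.mkℚᵘ i k
toℚᵘ-/ i k = ℚ.toℚᵘ-fromℚᵘ (ℚᵘ.mkℚᵘ i k)

+m/n≤+k/l : ∀ m n k l .{{_ : ℕ.NonZero n}} .{{_ : ℕ.NonZero l}} →
            m * l ≤ℕ k * n → + m / n ≤ + k / l
+m/n≤+k/l m (suc n) k (suc l) ml≤kn = ℚ.toℚᵘ-cancel-≤
  (ℚᵘ.≤-respʳ-≃ (ℚᵘ.≃-sym (toℚᵘ-/ (+ k) l)) (ℚᵘ.≤-respˡ-≃ (ℚᵘ.≃-sym (toℚᵘ-/ (+ m) n))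
    (ℚᵘ.*≤* (subst₂ ℤ._≤_ (ℤ.pos-* m (suc l)) (ℤ.pos-* k (suc n)) (ℤ.+≤+ ml≤kn)))))

[-i]/n≡-[i/n] : ∀ i n .{{_ : ℕ.NonZero n}} → (ℤ.- i) / n ≡ ℚ.- (i / n)
[-i]/n≡-[i/n] i (suc n) = ℚ.toℚᵘ-injective (ℚᵘ.≃-trans (toℚᵘ-/ (ℤ.- i) n)
  (ℚᵘ.≃-trans (ℚᵘ.-‿cong (ℚᵘ.≃-sym (toℚᵘ-/ i n))) (ℚᵘ.≃-sym (ℚ.toℚᵘ-homo‿- (i / suc n)))))

-1^_ : ℕ → ℚ
-1^ zero  = 1ℚ
-1^ suc t = ℚ.- (-1^ t)

[-1^t*i]/n≡-1^t*[i/n] : ∀ t i n .{{_ : ℕ.NonZero n}} → ((-1ℤ ℤ.^ t) ℤ.* i) / n ≡ (-1^ t) ℚ.* (i / n)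
[-1^t*i]/n≡-1^t*[i/n] zero    i n = trans (cong (_/ n) (ℤ.*-identityˡ i)) (sym (ℚ.*-identityˡ (i / n)))
[-1^t*i]/n≡-1^t*[i/n] (suc t) i n = begin
  ((-1ℤ ℤ.* (-1ℤ ℤ.^ t)) ℤ.* i) / n  ≡⟨ cong (_/ n) (ℤ.*-assoc -1ℤ (-1ℤ ℤ.^ t) i) ⟩
  (-1ℤ ℤ.* ((-1ℤ ℤ.^ t) ℤ.* i)) / n  ≡⟨ cong (_/ n) (ℤ.-1*i≡-i ((-1ℤ ℤ.^ t) ℤ.* i)) ⟩
  (ℤ.- ((-1ℤ ℤ.^ t) ℤ.* i)) / n      ≡⟨ [-i]/n≡-[i/n] ((-1ℤ ℤ.^ t) ℤ.* i) n ⟩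
  ℚ.- (((-1ℤ ℤ.^ t) ℤ.* i) / n)      ≡⟨ cong ℚ.-_ ([-1^t*i]/n≡-1^t*[i/n] t i n) ⟩
  ℚ.- ((-1^ t) ℚ.* (i / n))          ≡⟨ ℚ.neg-distribˡ-* (-1^ t) (i / n) ⟩
  (-1^ suc t) ℚ.* (i / n)            ∎
  where open ≡-Reasoning

alternatingSum : (ℕ → ℚ) → ℕ → ℚ
alternatingSum c zero    = 0ℚ
alternatingSum c (suc n) = c 0 - alternatingSum (c ∘ suc) n

p≤q⇒0≤q-p : ∀ {p q} → p ≤ q → 0ℚ ≤ q - p
p≤q⇒0≤q-p {p} {q} p≤q = subst (_≤ q - p) (ℚ.+-inverseʳ q) (ℚ.+-monoʳ-≤ q (ℚ.neg-antimono-≤ p≤q))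

0≤q⇒p-q≤p : ∀ {p q} → 0ℚ ≤ q → p - q ≤ p
0≤q⇒p-q≤p {p} {q} 0≤q = subst (p - q ≤_) (ℚ.+-identityʳ p) (ℚ.+-monoʳ-≤ p (ℚ.neg-antimono-≤ 0≤q))

alternatingSum-bounds : ∀ (c : ℕ → ℚ) → (∀ t → 0ℚ ≤ c t) → (∀ t → c (suc t) ≤ c t) →
                        ∀ n → 0ℚ ≤ alternatingSum c n × alternatingSum c n ≤ c 0
alternatingSum-bounds c c≥0 c↓ zero    = ℚ.≤-refl , c≥0 0
alternatingSum-bounds c c≥0 c↓ (suc n) =
  let 0≤tail , tail≤c1 = alternatingSum-bounds (c ∘ suc) (c≥0 ∘ suc) (c↓ ∘ suc) n
  in  p≤q⇒0≤q-p (ℚ.≤-trans tail≤c1 (c↓ 0)) , 0≤q⇒p-q≤p 0≤tail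

foldr-+-alternating : ∀ (σ c b : ℕ → ℚ) → (∀ t → σ (suc t) ≡ ℚ.- σ t) → (∀ t → b t ≡ σ t ℚ.* c t) →
                      ∀ n → foldr ℚ._+_ 0ℚ (applyUpTo b n) ≡ σ 0 ℚ.* alternatingSum c n
foldr-+-alternating σ c b σ-alt b≡σc zero    = sym (ℚ.*-zeroʳ (σ 0))
foldr-+-alternating σ c b σ-alt b≡σc (suc n) = begin
  b 0 ℚ.+ foldr ℚ._+_ 0ℚ (applyUpTo (b ∘ suc) n)
    ≡⟨ cong₂ ℚ._+_ (b≡σc 0) (foldr-+-alternating (σ ∘ suc) (c ∘ suc) (b ∘ suc) (σ-alt ∘ suc) (b≡σc ∘ suc) n) ⟩
  σ 0 ℚ.* c 0 ℚ.+ σ 1 ℚ.* A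
    ≡⟨ cong (λ s → σ 0 ℚ.* c 0 ℚ.+ s ℚ.* A) (σ-alt 0) ⟩
  σ 0 ℚ.* c 0 ℚ.+ ℚ.- σ 0 ℚ.* A
    ≡⟨ cong (σ 0 ℚ.* c 0 ℚ.+_) (trans (sym (ℚ.neg-distribˡ-* (σ 0) A)) (ℚ.neg-distribʳ-* (σ 0) A)) ⟩
  σ 0 ℚ.* c 0 ℚ.+ σ 0 ℚ.* ℚ.- A
    ≡⟨ ℚ.*-distribˡ-+ (σ 0) (c 0) (ℚ.- A) ⟨
  σ 0 ℚ.* (c 0 - A)
    ∎
  where
  open ≡-Reasoning
  A = alternatingSum (c ∘ suc) n

∣term∣ : ℕ → ℕ → ℕ → ℚ
∣term∣ x e t = (+ (e C t) / (x + t) !) {{(x + t) !≢0}}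

S≡alternatingSum-∣term∣ : ∀ x e → S x e ≡ alternatingSum (∣term∣ x e) (suc e)
S≡alternatingSum-∣term∣ x e = begin
  foldr ℚ._+_ 0ℚ (map (term x e) (upTo (suc e)))
    ≡⟨ cong (foldr ℚ._+_ 0ℚ) (map-upTo (term x e) (suc e)) ⟩
  foldr ℚ._+_ 0ℚ (applyUpTo (term x e) (suc e))
    ≡⟨ foldr-+-alternating -1^_ (∣term∣ x e) (term x e) (λ _ → refl) term≡±∣term∣ (suc e) ⟩
  1ℚ ℚ.* alternatingSum (∣term∣ x e) (suc e)
    ≡⟨ ℚ.*-identityˡ _ ⟩
  alternatingSum (∣term∣ x e) (suc e)
    ∎
  where
  open ≡-Reasoning
  term≡±∣term∣ : ∀ t → term x e t ≡ (-1^ t) ℚ.* ∣term∣ x e t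
  term≡±∣term∣ t = [-1^t*i]/n≡-1^t*[i/n] t (+ (e C t)) ((x + t) !) {{(x + t) !≢0}}

0≤∣term∣ : ∀ x e t → 0ℚ ≤ ∣term∣ x e t
0≤∣term∣ x e t = +m/n≤+k/l 0 1 (e C t) ((x + t) !) {{_}} {{(x + t) !≢0}} z≤n

∣term∣-antitone : ∀ {x e} → e ≤ℕ suc x → ∀ t → ∣term∣ x e (suc t) ≤ ∣term∣ x e t
∣term∣-antitone {x} {e} e≤1+x t =
  +m/n≤+k/l (e C suc t) ((x + suc t) !) (e C t) ((x + t) !) {{(x + suc t) !≢0}} {{(x + t) !≢0}}
    (subst (λ m → (e C suc t) * (x + t) ! ≤ℕ (e C t) * m !) (sym (ℕ.+-suc x t))
      (eC[t+1]*n!≤eCt*[n+1]! t (ℕ.≤-trans e≤1+x (s≤s (ℕ.m≤m+n x t)))))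

∣term∣₀≤invFact : ∀ x e {m} → m ≤ℕ x → ∣term∣ x e 0 ≤ invFact m
∣term∣₀≤invFact x e {m} m≤x =
  +m/n≤+k/l 1 ((x + 0) !) 1 (m !) {{(x + 0) !≢0}} {{m !≢0}}
    (ℕ.*-monoʳ-≤ 1 (!-mono-≤ (ℕ.≤-trans m≤x (ℕ.m≤m+n x 0))))

lemma4 : (x e p : ℕ) → p ≤ℕ x → 5 * e ≤ℕ 3 * x →
    (0ℚ ≤ S x e) × (S x e ≤ invFact (x ∸ p))
lemma4 x e p _ 5e≤3x =
  let 0≤S , S≤∣term∣₀ = alternatingSum-bounds (∣term∣ x e) (0≤∣term∣ x e) (∣term∣-antitone e≤1+x) (suc e)
  in  subst (λ s → 0ℚ ≤ s × s ≤ invFact (x ∸ p)) (sym (S≡alternatingSum-∣term∣ x e))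
        (0≤S , ℚ.≤-trans S≤∣term∣₀ (∣term∣₀≤invFact x e (ℕ.m∸n≤m x p)))
  where
  e≤1+x : e ≤ℕ suc x
  e≤1+x = ℕ.m≤n⇒m≤1+n (ℕ.*-cancelˡ-≤ 3 (ℕ.≤-trans (ℕ.*-monoˡ-≤ e {3} {5} (ℕ.m≤m+n 3 2)) 5e≤3x))
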